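{- Let $G$ be a bipartite graph of maximum vertex degree $\Delta$ that admits an $s$-stack layout. Then $\mathrm{dsn}(G) \le s\cdot\Delta$.
   Context: All graphs are finite, simple and undirected. A vertex order $\sigma$ is a total order of the vertices; two edges $(u,v)$, $(x,y)$ cross with respect to $\sigma$ if $u <_\sigma x <_\sigma v <_\sigma y$. An $s$-stack layout is a vertex order with a partition of the edges into $s$ sets of pairwise non-crossing edges. A dispersable stack layout is a stack layout in which the edges of each stack form a matching (pairwise vertex-disjoint edges); $\mathrm{dsn}(G)$ is the minimum number of stacks in a dispersable stack layout of $G$. -}

module Defs where

open import Data.Nat using (ℕ; _⊔_)
open import Data.Bool using (Bool; true; false; if_then_else_)
open import Data.Fin using (Fin; _<_)
open import Data.Fin.Permutation using (Permutation′; _⟨$⟩ʳ_)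
open import Data.List using (List; map; foldr; allFin)
open import Data.Nat.ListAction using (sum)
open import Data.Product using (Σ; ∃; ∃-syntax; _×_; _,_; proj₁; proj₂)
open import Data.Sum using (_⊎_)
open import Relation.Binary.PropositionalEquality using (_≡_; _≢_)
open import Relation.Nullary using (¬_)

record Graph : Set where
  field
    n       : ℕ
    Adj     : Fin n → Fin n → Bool
    Adj-sym : ∀ u v → Adj u v ≡ Adj v u
    irrefl  : ∀ v → Adj v v ≡ false
open Graph public

-- An edge {u,v}, stored once with u < v (as elements of Fin n).
Edge : Graph → Set
Edge G = Σ (Fin (n G) × Fin (n G)) λ p → (proj₁ p < proj₂ p) × (Adj G (proj₁ p) (proj₂ p) ≡ true)

HasEnds : (G : Graph) → Edge G → Fin (n G) → Fin (n G) → Set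
HasEnds G e u v =
  ((proj₁ (proj₁ e) ≡ u) × (proj₂ (proj₁ e) ≡ v)) ⊎ ((proj₁ (proj₁ e) ≡ v) × (proj₂ (proj₁ e) ≡ u))

Incident : (G : Graph) → Edge G → Fin (n G) → Set
Incident G e w = (proj₁ (proj₁ e) ≡ w) ⊎ (proj₂ (proj₁ e) ≡ w)

degree : (G : Graph) → Fin (n G) → ℕ
degree G v = sum (map (λ u → if Adj G v u then 1 else 0) (allFin (n G)))

maxDegree : Graph → ℕ
maxDegree G = foldr _⊔_ 0 (map (degree G) (allFin (n G)))

Bipartite : Graph → Set
Bipartite G = Σ (Fin (n G) → Bool) λ c → ∀ u v → Adj G u v ≡ true → c u ≢ c v

-- A vertex order: σ ⟨$⟩ʳ v is the position of v.
VertexOrder : Graph → Set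
VertexOrder G = Permutation′ (n G)

Cross : (G : Graph) → VertexOrder G → Edge G → Edge G → Set
Cross G σ e f = ∃[ u ] ∃[ v ] ∃[ x ] ∃[ y ]
  (HasEnds G e u v × HasEnds G f x y ×
   ((σ ⟨$⟩ʳ u) < (σ ⟨$⟩ʳ x)) × ((σ ⟨$⟩ʳ x) < (σ ⟨$⟩ʳ v)) × ((σ ⟨$⟩ʳ v) < (σ ⟨$⟩ʳ y)))

record StackLayout (G : Graph) (s : ℕ) : Set where
  field
    order    : VertexOrder G
    stack    : Edge G → Fin s
    noCross  : ∀ e f → stack e ≡ stack f → ¬ Cross G order e f

record DispersableLayout (G : Graph) (s : ℕ) : Set where
  field
    layout   : StackLayout G s
    matching : ∀ e f w → StackLayout.stack layout e ≡ StackLayout.stack layout f →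
               Incident G e w → Incident G f w → e ≡ f

DsnAtMost : Graph → ℕ → Set
DsnAtMost G k = ∃[ m ] (m Data.Nat.≤ k × DispersableLayout G m)

-- Refine every page by a proper edge colouring: by König's edge colouring
-- theorem a bipartite graph of maximum degree Δ has a proper Δ-edge-colouring,
-- and the pairs (page, colour) index s·Δ pages, each a crossing-free matching.
-- König's theorem is proved by colouring the edges one at a time. To colour uv
-- take a colour a free at u and b free at v; if a ≠ b, swap a and b along the
-- a/b-alternating path starting at v. That path enters u's side only through
-- a-edges, so it never reaches u, and afterwards a is free at both ends.
module Submission where

open import Defs
open import Data.Nat using (ℕ; zero; suc; _+_; _*_; _≤_; _<_; _⊔_; z≤n; s≤s)
import Data.Nat.Properties as ℕ
open import Data.Bool using (Bool; true; false; if_then_else_)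
import Data.Bool.Properties as Bool
open import Data.Fin using (Fin; zero; suc; combine; _≟_)
import Data.Fin.Properties as Fin
open import Data.Fin.Subset using (Subset; _∈_; _-_; ∣_∣)
open import Data.Fin.Subset.Properties using (x∈p∧x≢y⇒x∈p-y; x∈p⇒∣p-x∣<∣p∣)
open import Data.Maybe using (Maybe; just; nothing)
open import Data.Maybe.Properties using (just-injective)
import Data.Maybe.Properties as Maybe
open import Data.List using (List; []; _∷_; foldr; allFin; cartesianProduct)
import Data.List as List
import Data.List.Properties as List
open import Data.List.Membership.Propositional using () renaming (_∈_ to _∈ˡ_)
open import Data.List.Membership.Propositional.Properties
  using (∈-map⁺; ∈-allFin; ∈-cartesianProduct⁺)
open import Data.List.Relation.Unary.Any using (here; there)
open import Data.Nat.ListAction using (sum)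
open import Data.Product using (Σ; ∃-syntax; _×_; _,_; proj₁; proj₂; map₂)
open import Data.Sum using (_⊎_; inj₁; inj₂)
open import Data.Vec using (tabulate)
open import Data.Vec.Properties using (lookup⇒[]=; lookup∘tabulate)
open import Data.Empty using (⊥-elim)
open import Function using (_∘_; id)
open import Function.Definitions using (Injective)
open import Relation.Nullary using (¬_; Dec; yes; no; contradiction)
open import Relation.Binary.PropositionalEquality
open import Axiom.UniquenessOfIdentityProofs using (module Decidable⇒UIP)

∑ : ∀ {n} → (Fin n → ℕ) → ℕ
∑ {zero}  f = 0
∑ {suc n} f = f zero + ∑ (f ∘ suc)

∑-mono-≤ : ∀ {n} {f g : Fin n → ℕ} → (∀ i → f i ≤ g i) → ∑ f ≤ ∑ g
∑-mono-≤ {zero}  f≤g = z≤n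
∑-mono-≤ {suc n} f≤g = ℕ.+-mono-≤ (f≤g zero) (∑-mono-≤ (f≤g ∘ suc))

∑-mono-< : ∀ {n} {f g : Fin n → ℕ} → (∀ i → f i ≤ g i) → ∀ j → f j < g j → ∑ f < ∑ g
∑-mono-< f≤g zero    fj<gj = ℕ.+-mono-<-≤ fj<gj (∑-mono-≤ (f≤g ∘ suc))
∑-mono-< f≤g (suc j) fj<gj = ℕ.+-mono-≤-< (f≤g zero) (∑-mono-< (f≤g ∘ suc) j fj<gj)

injective⇒≤∣p∣ : ∀ {k n} {p : Subset n} (f : Fin k → Fin n) →
                 Injective _≡_ _≡_ f → (∀ i → f i ∈ p) → k ≤ ∣ p ∣
injective⇒≤∣p∣ {zero}          f f-inj f∈p = z≤n
injective⇒≤∣p∣ {suc k} {p = p} f f-inj f∈p =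
  ℕ.≤-<-trans k≤∣p-f₀∣ (x∈p⇒∣p-x∣<∣p∣ (f∈p zero))
  where
  k≤∣p-f₀∣ : k ≤ ∣ p - f zero ∣
  k≤∣p-f₀∣ = injective⇒≤∣p∣ (f ∘ suc) (Fin.suc-injective ∘ f-inj)
    (λ i → x∈p∧x≢y⇒x∈p-y (f∈p (suc i)) (Fin.0≢1+n ∘ sym ∘ f-inj))

∣tabulate∣≡sum : ∀ {n} (p : Fin n → Bool) →
                 ∣ tabulate p ∣ ≡ sum (List.tabulate (λ x → if p x then 1 else 0))
∣tabulate∣≡sum {zero}  p = refl
∣tabulate∣≡sum {suc n} p with p zero
... | true  = cong suc (∣tabulate∣≡sum (p ∘ suc))
... | false = ∣tabulate∣≡sum (p ∘ suc)

∈-tabulate⁺ : ∀ {n} {p : Fin n → Bool} {x} → p x ≡ true → x ∈ tabulate p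
∈-tabulate⁺ {p = p} {x} px = lookup⇒[]= x (tabulate p) (trans (lookup∘tabulate p x) px)

∈⇒≤foldr-⊔ : ∀ {m ms} → m ∈ˡ ms → m ≤ foldr _⊔_ 0 ms
∈⇒≤foldr-⊔               (here refl) = ℕ.m≤m⊔n _ _
∈⇒≤foldr-⊔ {ms = m′ ∷ _} (there m∈) = ℕ.≤-trans (∈⇒≤foldr-⊔ m∈) (ℕ.m≤n⊔m m′ _)

degree≡∣neighbours∣ : (G : Graph) (v : Fin (n G)) → degree G v ≡ ∣ tabulate (Adj G v) ∣
degree≡∣neighbours∣ G v =
  trans (cong sum (List.map-tabulate id (λ u → if Adj G v u then 1 else 0)))
        (sym (∣tabulate∣≡sum (Adj G v)))

degree≤maxDegree : (G : Graph) (v : Fin (n G)) → degree G v ≤ maxDegree G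
degree≤maxDegree G v = ∈⇒≤foldr-⊔ (∈-map⁺ (degree G) (∈-allFin v))

ends-injective : (G : Graph) {e f : Edge G} {u v : Fin (n G)} →
                 HasEnds G e u v → HasEnds G f u v → e ≡ f
ends-injective G {e} {f} = go e f
  where
  same-proofs : ∀ {u v} (lt lt′ : u Data.Fin.< v) (uv uv′ : Adj G u v ≡ true) →
                _≡_ {A = Edge G} ((u , v) , lt , uv) ((u , v) , lt′ , uv′)
  same-proofs lt lt′ uv uv′ =
    cong₂ (λ lt adj → (_ , lt , adj)) (Fin.<-irrelevant lt lt′) (Decidable⇒UIP.≡-irrelevant Bool._≟_ uv uv′)

  go : ∀ e f {u v} → HasEnds G e u v → HasEnds G f u v → e ≡ f
  go (_ , lt , uv) (_ , lt′ , uv′) (inj₁ (refl , refl)) (inj₁ (refl , refl)) = same-proofs lt lt′ uv uv′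
  go (_ , lt , uv) (_ , lt′ , uv′) (inj₂ (refl , refl)) (inj₂ (refl , refl)) = same-proofs lt lt′ uv uv′
  go (_ , lt , _)  (_ , lt′ , _)   (inj₁ (refl , refl)) (inj₂ (refl , refl)) = ⊥-elim (Fin.<-asym lt lt′)
  go (_ , lt , _)  (_ , lt′ , _)   (inj₂ (refl , refl)) (inj₁ (refl , refl)) = ⊥-elim (Fin.<-asym lt lt′)

ProperEdgeColouring : Graph → ℕ → Set
ProperEdgeColouring G k =
  Σ (Edge G → Fin k) λ colour →
    ∀ e f w → colour e ≡ colour f → Incident G e w → Incident G f w → e ≡ f

module König (G : Graph) (side : Fin (n G) → Bool)
             (proper : ∀ u v → Adj G u v ≡ true → side u ≢ side v)
             (Δ : ℕ) (degree≤Δ : ∀ v → degree G v ≤ Δ) where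

  V : Set
  V = Fin (n G)

  _~_ : V → V → Set
  u ~ v = Adj G u v ≡ true

  ~-sym : ∀ {u v} → u ~ v → v ~ u
  ~-sym {u} {v} = trans (Adj-sym G v u)

  ~-irrefl : ∀ {u v} → u ~ v → u ≢ v
  ~-irrefl u~v refl = proper _ _ u~v refl

  -- M x a ≡ just y says that the edge xy has colour a: a partial colouring is
  -- stored as the partner of every vertex in each of the Δ colour matchings.
  Mates : Set
  Mates = V → Fin Δ → Maybe V

  record IsColouring (M : Mates) : Set where
    field
      mate-sym    : ∀ {x y a} → M x a ≡ just y → M y a ≡ just x
      mate-edge   : ∀ {x y a} → M x a ≡ just y → x ~ y
      mate-unique : ∀ {x y a b} → M x a ≡ just y → M x b ≡ just y → a ≡ b
  open IsColouring

  Coloured : Mates → V → V → Set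
  Coloured M x y = ∃[ a ] M x a ≡ just y

  _⊑_ : Mates → Mates → Set
  M ⊑ M′ = ∀ {x y} → Coloured M x y → Coloured M′ x y

  coloured? : ∀ M x y → Dec (Coloured M x y)
  coloured? M x y = Fin.any? (λ a → Maybe.≡-dec _≟_ (M x a) (just y))

  coloured-sym : ∀ {M} → IsColouring M → ∀ {x y} → Coloured M x y → Coloured M y x
  coloured-sym M-col = map₂ (mate-sym M-col)

  data Ends (w y : V) : V → V → Set where
    forward  : Ends w y w y
    backward : Ends w y y w

  occupied : Maybe V → ℕ
  occupied nothing  = 0
  occupied (just _) = 1

  occupied-mono : ∀ {m m′ : Maybe V} → (∀ {z} → m ≡ just z → m′ ≡ just z) →
                  occupied m ≤ occupied m′
  occupied-mono {nothing}         m⊆m′ = z≤n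
  occupied-mono {just z}  {m′}    m⊆m′ with m′ | m⊆m′ refl
  ... | just _ | _ = ℕ.≤-refl

  weight : Mates → ℕ
  weight M = ∑ λ x → ∑ λ a → occupied (M x a)

  relink : Mates → V → V → Fin Δ → Maybe V → Maybe V → Mates
  relink M w y c mw my x a with a ≟ c | x ≟ w | x ≟ y
  ... | no _  | _     | _     = M x a
  ... | yes _ | yes _ | _     = mw
  ... | yes _ | no _  | yes _ = my
  ... | yes _ | no _  | no _  = M x a

  module _ (M : Mates) (w y : V) (c : Fin Δ) (mw my : Maybe V) where

    relink-w : relink M w y c mw my w c ≡ mw
    relink-w with c ≟ c | w ≟ w
    ... | yes _   | yes _   = refl
    ... | no c≢c  | _       = contradiction refl c≢c
    ... | yes _   | no w≢w  = contradiction refl w≢w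

    relink-y : w ≢ y → relink M w y c mw my y c ≡ my
    relink-y w≢y with c ≟ c | y ≟ w | y ≟ y
    ... | yes _  | no _    | yes _  = refl
    ... | no c≢c | _       | _      = contradiction refl c≢c
    ... | yes _  | yes y≡w | _      = contradiction (sym y≡w) w≢y
    ... | yes _  | no _    | no y≢y = contradiction refl y≢y

    relink-cases : ∀ x a → relink M w y c mw my x a ≡ M x a ⊎ (a ≡ c × (x ≡ w ⊎ x ≡ y))
    relink-cases x a with a ≟ c | x ≟ w | x ≟ y
    ... | no _    | _       | _       = inj₁ refl
    ... | yes a≡c | yes x≡w | _       = inj₂ (a≡c , inj₁ x≡w)
    ... | yes a≡c | no _    | yes x≡y = inj₂ (a≡c , inj₂ x≡y)
    ... | yes _   | no _    | no _    = inj₁ refl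

    relink-off : ∀ {x a} → a ≢ c → relink M w y c mw my x a ≡ M x a
    relink-off {x} {a} a≢c with relink-cases x a
    ... | inj₁ unchanged = unchanged
    ... | inj₂ (a≡c , _) = contradiction a≡c a≢c

    relink-elsewhere : ∀ {x a} → x ≢ w → x ≢ y → relink M w y c mw my x a ≡ M x a
    relink-elsewhere {x} {a} x≢w x≢y with relink-cases x a
    ... | inj₁ unchanged          = unchanged
    ... | inj₂ (_ , inj₁ x≡w)     = contradiction x≡w x≢w
    ... | inj₂ (_ , inj₂ x≡y)     = contradiction x≡y x≢y

  module Unlink {M : Mates} (M-col : IsColouring M) {w y : V} {c : Fin Δ}
                (wcy : M w c ≡ just y) where

    R : Mates
    R = relink M w y c nothing nothing

    ycw : M y c ≡ just w
    ycw = mate-sym M-col wcy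

    R-wc : R w c ≡ nothing
    R-wc = relink-w M w y c nothing nothing

    R-yc : R y c ≡ nothing
    R-yc = relink-y M w y c nothing nothing (~-irrefl (mate-edge M-col wcy))

    R⊆M : ∀ x a {z} → R x a ≡ just z → M x a ≡ just z
    R⊆M x a Rxa with relink-cases M w y c nothing nothing x a
    ... | inj₁ unchanged             = trans (sym unchanged) Rxa
    ... | inj₂ (refl , inj₁ refl)    = contradiction (trans (sym R-wc) Rxa) λ ()
    ... | inj₂ (refl , inj₂ refl)    = contradiction (trans (sym R-yc) Rxa) λ ()

    ¬R-to-w : ∀ {x} → R x c ≢ just w
    ¬R-to-w {x} Rxc with just-injective (trans (sym wcy) (mate-sym M-col (R⊆M x c Rxc)))
    ... | refl = contradiction (trans (sym R-yc) Rxc) λ ()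

    ¬R-to-y : ∀ {x} → R x c ≢ just y
    ¬R-to-y {x} Rxc with just-injective (trans (sym ycw) (mate-sym M-col (R⊆M x c Rxc)))
    ... | refl = contradiction (trans (sym R-wc) Rxc) λ ()

    R-sym : ∀ {x z a} → R x a ≡ just z → R z a ≡ just x
    R-sym {x} {z} {a} Rxa with relink-cases M w y c nothing nothing z a
    ... | inj₁ unchanged          = trans unchanged (mate-sym M-col (R⊆M x a Rxa))
    ... | inj₂ (refl , inj₁ refl) = contradiction Rxa ¬R-to-w
    ... | inj₂ (refl , inj₂ refl) = contradiction Rxa ¬R-to-y

    R-col : IsColouring R
    R-col = record
      { mate-sym    = λ {x} {z} {a} → R-sym {x} {z} {a}
      ; mate-edge   = λ {x} {_} {a} Rxa → mate-edge M-col (R⊆M x a Rxa)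
      ; mate-unique = λ {x} {_} {a} {b} Rxa Rxb →
                        mate-unique M-col (R⊆M x a Rxa) (R⊆M x b Rxb)
      }

    R-elsewhere : ∀ {x a} → x ≢ w → x ≢ y → R x a ≡ M x a
    R-elsewhere = relink-elsewhere M w y c nothing nothing

    R-coloured : ∀ {x z} → Coloured M x z → Coloured R x z ⊎ Ends w y x z
    R-coloured {x} (a , Mxa) with relink-cases M w y c nothing nothing x a
    ... | inj₁ unchanged = inj₁ (a , trans unchanged Mxa)
    ... | inj₂ (refl , inj₁ refl) with just-injective (trans (sym wcy) Mxa)
    ...   | refl = inj₂ forward
    R-coloured (a , Mxa) | inj₂ (refl , inj₂ refl) with just-injective (trans (sym ycw) Mxa)
    ...   | refl = inj₂ backward

    R-uncoloured : ¬ Coloured R w y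
    R-uncoloured (a , Rway) with mate-unique M-col (R⊆M w a Rway) wcy
    ... | refl = contradiction (trans (sym R-wc) Rway) λ ()

    weight-R : weight R < weight M
    weight-R = ∑-mono-< (λ x → ∑-mono-≤ (λ a → occupied-mono (R⊆M x a))) w
                 (∑-mono-< (λ a → occupied-mono (R⊆M w a)) c occupied-wc)
      where
      occupied-wc : occupied (R w c) < occupied (M w c)
      occupied-wc rewrite R-wc | wcy = s≤s z≤n

  module Link {M : Mates} (M-col : IsColouring M) {w y : V} {d : Fin Δ} (w~y : w ~ y)
              (w-free : M w d ≡ nothing) (y-free : M y d ≡ nothing)
              (uncoloured : ¬ Coloured M w y) where

    A : Mates
    A = relink M w y d (just y) (just w)

    A-wd : A w d ≡ just y
    A-wd = relink-w M w y d (just y) (just w)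

    A-yd : A y d ≡ just w
    A-yd = relink-y M w y d (just y) (just w) (~-irrefl w~y)

    A-cases : ∀ x a {z} → A x a ≡ just z → M x a ≡ just z ⊎ (a ≡ d × Ends w y x z)
    A-cases x a Axa with relink-cases M w y d (just y) (just w) x a
    ... | inj₁ unchanged = inj₁ (trans (sym unchanged) Axa)
    ... | inj₂ (refl , inj₁ refl) with just-injective (trans (sym A-wd) Axa)
    ...   | refl = inj₂ (refl , forward)
    A-cases x a Axa | inj₂ (refl , inj₂ refl) with just-injective (trans (sym A-yd) Axa)
    ...   | refl = inj₂ (refl , backward)

    M⊆A : ∀ {x a z} → M x a ≡ just z → A x a ≡ just z
    M⊆A {x} {a} Mxa with relink-cases M w y d (just y) (just w) x a
    ... | inj₁ unchanged          = trans unchanged Mxa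
    ... | inj₂ (refl , inj₁ refl) = contradiction (trans (sym w-free) Mxa) λ ()
    ... | inj₂ (refl , inj₂ refl) = contradiction (trans (sym y-free) Mxa) λ ()

    ends-uncoloured : ∀ {x z a} → Ends w y x z → M x a ≢ just z
    ends-uncoloured forward  Mwy = uncoloured (_ , Mwy)
    ends-uncoloured backward Myw = uncoloured (_ , mate-sym M-col Myw)

    A-sym : ∀ {x z a} → A x a ≡ just z → A z a ≡ just x
    A-sym {x} {_} {a} Axa with A-cases x a Axa
    ... | inj₁ Mxa               = M⊆A (mate-sym M-col Mxa)
    ... | inj₂ (refl , forward)  = A-yd
    ... | inj₂ (refl , backward) = A-wd

    A-edge : ∀ {x z a} → A x a ≡ just z → x ~ z
    A-edge {x} {_} {a} Axa with A-cases x a Axa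
    ... | inj₁ Mxa               = mate-edge M-col Mxa
    ... | inj₂ (refl , forward)  = w~y
    ... | inj₂ (refl , backward) = ~-sym w~y

    A-unique : ∀ {x z a b} → A x a ≡ just z → A x b ≡ just z → a ≡ b
    A-unique {x} {_} {a} {b} Axa Axb with A-cases x a Axa | A-cases x b Axb
    ... | inj₁ Mxa         | inj₁ Mxb         = mate-unique M-col Mxa Mxb
    ... | inj₁ Mxa         | inj₂ (_ , ends)  = contradiction Mxa (ends-uncoloured ends)
    ... | inj₂ (_ , ends)  | inj₁ Mxb         = contradiction Mxb (ends-uncoloured ends)
    ... | inj₂ (refl , _)  | inj₂ (refl , _)  = refl

    A-col : IsColouring A
    A-col = record
      { mate-sym    = λ {x} {z} {a} → A-sym {x} {z} {a}
      ; mate-edge   = λ {x} {z} {a} → A-edge {x} {z} {a}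
      ; mate-unique = λ {x} {z} {a} {b} → A-unique {x} {z} {a} {b}
      }

    M⊑A : M ⊑ A
    M⊑A = map₂ M⊆A

    A-coloured : ∀ {x z} → Coloured A x z → Coloured M x z ⊎ Ends w y x z
    A-coloured {x} (a , Axa) with A-cases x a Axa
    ... | inj₁ Mxa        = inj₁ (a , Mxa)
    ... | inj₂ (_ , ends) = inj₂ ends

  -- The result of swapping c and d along the c/d-alternating path from w.
  -- That path reaches w's far side through c-edges and w's near side through
  -- d-edges, so vertices missing the corresponding colour are not on it.
  record Recoloured (M : Mates) (w : V) (c d : Fin Δ) : Set where
    field
      mates      : Mates
      colouring  : IsColouring mates
      c-free     : mates w c ≡ nothing
      coloured⁺  : M ⊑ mates
      coloured⁻  : mates ⊑ M
      far-fixed  : ∀ {x} → side x ≢ side w → M x c ≡ nothing → ∀ a → mates x a ≡ M x a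
      near-fixed : ∀ {x} → side x ≡ side w → x ≢ w → M x d ≡ nothing → ∀ a → mates x a ≡ M x a

  already-free : ∀ {M} → IsColouring M → ∀ {w c d} → M w c ≡ nothing → Recoloured M w c d
  already-free {M} M-col wc = record
    { mates = M ; colouring = M-col ; c-free = wc ; coloured⁺ = id ; coloured⁻ = id
    ; far-fixed = λ _ _ _ → refl ; near-fixed = λ _ _ _ _ → refl }

  -- k bounds the weight, which drops when the first edge wy of the path is
  -- uncoloured before the rest of the path, starting at y, is swapped.
  kempe-swap : ∀ k {M} → weight M < k → IsColouring M → ∀ w {c d} → c ≢ d →
               M w d ≡ nothing → Recoloured M w c d
  kempe-swap (suc k) {M} weight<k M-col w {c} {d} c≢d wd with M w c in wc
  ... | nothing = already-free M-col wc
  ... | just y  = record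
    { mates = A ; colouring = A-col ; c-free = A-wc
    ; coloured⁺ = coloured⁺ ; coloured⁻ = coloured⁻
    ; far-fixed = far-fixed ; near-fixed = near-fixed }
    where
    open Unlink M-col wc
    rest : Recoloured R y d c
    rest = kempe-swap k (ℕ.<-≤-trans weight-R (ℕ.≤-pred weight<k)) R-col y (c≢d ∘ sym) R-yc
    module Rest = Recoloured rest

    w~y : w ~ y
    w~y = mate-edge M-col wc

    side-w≢side-y : side w ≢ side y
    side-w≢side-y = proper w y w~y

    R-wd : R w d ≡ nothing
    R-wd = trans (relink-off M w y c nothing nothing (c≢d ∘ sym)) wd

    Rest-w : ∀ a → Rest.mates w a ≡ R w a
    Rest-w = Rest.far-fixed side-w≢side-y R-wd

    open Link Rest.colouring w~y (trans (Rest-w d) R-wd) Rest.c-free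
                (R-uncoloured ∘ Rest.coloured⁻)

    A-wc : A w c ≡ nothing
    A-wc = trans (relink-off Rest.mates w y d (just y) (just w) c≢d) (trans (Rest-w c) R-wc)

    coloured⁺ : M ⊑ A
    coloured⁺ xz with R-coloured xz
    ... | inj₁ R-xz     = M⊑A (Rest.coloured⁺ R-xz)
    ... | inj₂ forward  = d , A-wd
    ... | inj₂ backward = d , A-yd

    coloured⁻ : A ⊑ M
    coloured⁻ xz with A-coloured xz
    ... | inj₁ Rest-xz  = map₂ (R⊆M _ _) (Rest.coloured⁻ Rest-xz)
    ... | inj₂ forward  = c , wc
    ... | inj₂ backward = c , ycw

    away : ∀ {x} → x ≢ w → x ≢ y → ∀ a → Rest.mates x a ≡ R x a →
           A x a ≡ M x a
    away x≢w x≢y a Rest-x =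
      trans (relink-elsewhere Rest.mates w y d (just y) (just w) x≢w x≢y)
            (trans Rest-x (R-elsewhere x≢w x≢y))

    far-fixed : ∀ {x} → side x ≢ side w → M x c ≡ nothing → ∀ a → A x a ≡ M x a
    far-fixed {x} x-far xc a =
      away x≢w x≢y a (Rest.near-fixed same-side x≢y (trans (R-elsewhere x≢w x≢y) xc) a)
      where
      x≢w : x ≢ w
      x≢w refl = x-far refl
      x≢y : x ≢ y
      x≢y refl = contradiction (trans (sym ycw) xc) λ ()
      same-side : side x ≡ side y
      same-side = trans (Bool.¬-not x-far) (sym (Bool.¬-not (side-w≢side-y ∘ sym)))

    near-fixed : ∀ {x} → side x ≡ side w → x ≢ w → M x d ≡ nothing → ∀ a → A x a ≡ M x a
    near-fixed {x} x-near x≢w xd a =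
      away x≢w x≢y a
        (Rest.far-fixed (side-w≢side-y ∘ trans (sym x-near)) (trans (R-elsewhere x≢w x≢y) xd) a)
      where
      x≢y : x ≢ y
      x≢y refl = side-w≢side-y (sym x-near)

  free-colour : ∀ {M} → IsColouring M → ∀ {u v} → u ~ v → ¬ Coloured M u v →
                ∃[ a ] M u a ≡ nothing
  free-colour {M} M-col {u} {v} u~v uncoloured
    with Fin.any? (λ a → Maybe.≡-dec _≟_ (M u a) nothing)
  ... | yes free = free
  ... | no ¬free = contradiction Δ<Δ (ℕ.<-irrefl refl)
    where
    mate : ∀ a → ∃[ z ] M u a ≡ just z
    mate a with M u a in ua
    ... | nothing = contradiction (a , ua) ¬free
    ... | just z  = z , refl

    mate-injective : Injective _≡_ _≡_ (proj₁ ∘ mate)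
    mate-injective {a} {b} same =
      mate-unique M-col (proj₂ (mate a)) (trans (proj₂ (mate b)) (cong just (sym same)))

    mate∈N-v : ∀ a → proj₁ (mate a) ∈ tabulate (Adj G u) - v
    mate∈N-v a =
      x∈p∧x≢y⇒x∈p-y (∈-tabulate⁺ {p = Adj G u} (mate-edge M-col (proj₂ (mate a))))
                   λ mate≡v → uncoloured (a , trans (proj₂ (mate a)) (cong just mate≡v))

    Δ<Δ : Δ < Δ
    Δ<Δ = begin-strict
      Δ                           ≤⟨ injective⇒≤∣p∣ (proj₁ ∘ mate) mate-injective mate∈N-v ⟩
      ∣ tabulate (Adj G u) - v ∣  <⟨ x∈p⇒∣p-x∣<∣p∣ (∈-tabulate⁺ {p = Adj G u} u~v) ⟩
      ∣ tabulate (Adj G u) ∣      ≡⟨ degree≡∣neighbours∣ G u ⟨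
      degree G u                  ≤⟨ degree≤Δ u ⟩
      Δ                           ∎
      where open ℕ.≤-Reasoning

  colour-edge : ∀ {M} → IsColouring M → ∀ {u v} → u ~ v → ¬ Coloured M u v →
                ∃[ M′ ] IsColouring M′ × M ⊑ M′ × Coloured M′ u v
  colour-edge {M} M-col {u} {v} u~v uncoloured
    with free-colour M-col u~v uncoloured
       | free-colour M-col (~-sym u~v) (uncoloured ∘ coloured-sym M-col)
  ... | a , ua | b , vb with a ≟ b
  ...   | yes refl = A , A-col , M⊑A , (a , A-wd)
    where open Link M-col u~v ua vb uncoloured
  ...   | no a≢b = A , A-col , (λ xz → M⊑A (Swap.coloured⁺ xz)) , (a , A-wd)
    where
    module Swap = Recoloured (kempe-swap _ (ℕ.n<1+n (weight M)) M-col v a≢b vb)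
    open Link Swap.colouring u~v (trans (Swap.far-fixed (proper u v u~v) ua a) ua)
              Swap.c-free (uncoloured ∘ Swap.coloured⁻)

  colour-pairs : (ps : List (V × V)) →
                 ∃[ M ] IsColouring M × (∀ {x z} → (x , z) ∈ˡ ps → x ~ z → Coloured M x z)
  colour-pairs [] =
    (λ _ _ → nothing) , record { mate-sym = λ () ; mate-edge = λ () ; mate-unique = λ () } , λ ()
  colour-pairs ((x , z) ∷ ps) with colour-pairs ps
  ... | M , M-col , covers with Adj G x z in xz | coloured? M x z
  ...   | false | _ = M , M-col , λ { (here refl) x~z → contradiction (trans (sym xz) x~z) λ ()
                                    ; (there p) → covers p }
  ...   | true | yes coloured = M , M-col , λ { (here refl) _ → coloured ; (there p) → covers p }
  ...   | true | no uncoloured with colour-edge M-col xz uncoloured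
  ...     | M′ , M′-col , M⊑M′ , coloured =
            M′ , M′-col , λ { (here refl) _ → coloured ; (there p) x~z → M⊑M′ (covers p x~z) }

  edge-colouring : ProperEdgeColouring G Δ
  edge-colouring = colour , proper-colour
    where
    pairs : List (V × V)
    pairs = cartesianProduct (allFin (n G)) (allFin (n G))

    all-pairs : ∃[ M ] IsColouring M × (∀ {x z} → (x , z) ∈ˡ pairs → x ~ z → Coloured M x z)
    all-pairs = colour-pairs pairs

    M : Mates
    M = proj₁ all-pairs

    M-col : IsColouring M
    M-col = proj₁ (proj₂ all-pairs)

    covers : ∀ {x z} → x ~ z → Coloured M x z
    covers {x} {z} = proj₂ (proj₂ all-pairs) (∈-cartesianProduct⁺ (∈-allFin x) (∈-allFin z))

    colour : Edge G → Fin Δ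
    colour (_ , _ , adj) = proj₁ (covers adj)

    mate-at : ∀ e w → Incident G e w → ∃[ z ] M w (colour e) ≡ just z × HasEnds G e w z
    mate-at (_ , _ , adj) _ (inj₁ refl) = _ , proj₂ (covers adj) , inj₁ (refl , refl)
    mate-at (_ , _ , adj) _ (inj₂ refl) =
      _ , mate-sym M-col (proj₂ (covers adj)) , inj₂ (refl , refl)

    proper-colour : ∀ e f w → colour e ≡ colour f → Incident G e w → Incident G f w → e ≡ f
    proper-colour e f w same e∋w f∋w with mate-at e w e∋w | mate-at f w f∋w
    ... | z , Mwz , e-ends | z′ , Mwz′ , f-ends
      with just-injective (trans (sym Mwz) (trans (cong (M w) same) Mwz′))
    ...   | refl = ends-injective G e-ends f-ends

könig-edge-colouring : (G : Graph) → Bipartite G → ∀ Δ → (∀ v → degree G v ≤ Δ) →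
                       ProperEdgeColouring G Δ
könig-edge-colouring G (side , proper) = König.edge-colouring G side proper

lemma3 : (G : Graph) (s : ℕ) → Bipartite G → StackLayout G s → DsnAtMost G (s * maxDegree G)
lemma3 G s bip L = s * maxDegree G , ℕ.≤-refl , record
  { layout   = record { order = order ; stack = page ; noCross = no-crossing }
  ; matching = matching }
  where
  open StackLayout L
  Δ : ℕ
  Δ = maxDegree G

  colouring : ProperEdgeColouring G Δ
  colouring = könig-edge-colouring G bip Δ (degree≤maxDegree G)

  page : Edge G → Fin (s * Δ)
  page e = combine (stack e) (proj₁ colouring e)

  page-injective : ∀ e f → page e ≡ page f →
                   stack e ≡ stack f × proj₁ colouring e ≡ proj₁ colouring f
  page-injective e f =
    Fin.combine-injective (stack e) (proj₁ colouring e) (stack f) (proj₁ colouring f)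

  no-crossing : ∀ e f → page e ≡ page f → ¬ Cross G order e f
  no-crossing e f same = noCross e f (proj₁ (page-injective e f same))

  matching : ∀ e f w → page e ≡ page f → Incident G e w → Incident G f w → e ≡ f
  matching e f w same = proj₂ colouring e f w (proj₂ (page-injective e f same))
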